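{- Let $A$ be an alphabet with at least two letters and $f: A^*\to B^*$ a non-erasing morphism that is not injective on $A^*$. Then $f$ is weakly quasiperiodic on finite words and weakly quasiperiodic on infinite words.
   Context: For a non-empty word $q$, a finite word $w$ is $q$-quasiperiodic if $w\neq q$ and every position of $w$ lies within some occurrence of $q$ in $w$; an infinite word is $q$-quasiperiodic if every position lies within some occurrence of $q$; a word is quasiperiodic if it is $q$-quasiperiodic for some $q$. $f$ is weakly quasiperiodic on finite words if there is a finite non-quasiperiodic word $u$ over $A$ with $f(u)$ quasiperiodic; it is weakly quasiperiodic on infinite words if there is an infinite non-quasiperiodic word $\mathbf{w}$ over $A$ with $f(\mathbf{w})$ quasiperiodic. -}

module Defs where

open import Data.Nat using (ℕ; zero; suc; _+_; _≤_; _<_)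
open import Data.Fin using (Fin)
open import Data.List using (List; []; _∷_; length; take; drop; concatMap; map; upTo; lookup)
open import Data.Maybe using (Maybe; just; nothing)
open import Data.Product using (Σ; ∃; _×_; _,_)
open import Relation.Binary.PropositionalEquality using (_≡_; _≢_)
open import Relation.Nullary using (¬_)

-- A morphism A* → B* is determined by the images of the letters.
Morphism : Set → Set → Set
Morphism A B = A → List B

_⋆ : {A B : Set} → Morphism A B → List A → List B
(h ⋆) u = concatMap h u

NonErasing : {A B : Set} → Morphism A B → Set
NonErasing {A} h = (a : A) → h a ≢ []

InjectiveOnWords : {A B : Set} → Morphism A B → Set
InjectiveOnWords {A} h = (u v : List A) → (h ⋆) u ≡ (h ⋆) v → u ≡ v

OccursAt : {X : Set} → List X → List X → ℕ → Set
OccursAt q w i = (i + length q ≤ length w) × (take (length q) (drop i w) ≡ q)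

QuasiperiodicBy : {X : Set} → List X → List X → Set
QuasiperiodicBy q w =
  (q ≢ []) × (w ≢ q) ×
  ((j : ℕ) → j < length w → ∃ λ i → (i ≤ j) × (j < i + length q) × OccursAt q w i)

Quasiperiodic : {X : Set} → List X → Set
Quasiperiodic {X} w = ∃ λ (q : List X) → QuasiperiodicBy q w

Stream : Set → Set
Stream X = ℕ → X

OccursAtω : {X : Set} → List X → Stream X → ℕ → Set
OccursAtω q w i = (k : Fin (length q)) → w (i + Data.Fin.toℕ k) ≡ lookup q k

QuasiperiodicByω : {X : Set} → List X → Stream X → Set
QuasiperiodicByω q w =
  (q ≢ []) ×
  ((j : ℕ) → ∃ λ i → (i ≤ j) × (j < i + length q) × OccursAtω q w i)

Quasiperiodicω : {X : Set} → Stream X → Set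
Quasiperiodicω {X} w = ∃ λ (q : List X) → QuasiperiodicByω q w

nth : {X : Set} → List X → ℕ → Maybe X
nth [] _ = nothing
nth (x ∷ _) zero = just x
nth (_ ∷ xs) (suc n) = nth xs n

prefix : {X : Set} → Stream X → ℕ → List X
prefix w n = map w (upTo n)

-- image of an infinite word under a morphism: letter n of h(w) is letter n of
-- h(w 0 … w n) (when h is non-erasing this is always 'just', and the stream
-- is exactly h(w) with every letter wrapped in 'just').
_ω : {A B : Set} → Morphism A B → Stream A → Stream (Maybe B)
(h ω) w n = nth ((h ⋆) (prefix w (suc n))) n

WeaklyQPFinite : {A B : Set} → Morphism A B → Set
WeaklyQPFinite {A} h = ∃ λ (u : List A) → ¬ Quasiperiodic u × Quasiperiodic ((h ⋆) u)

WeaklyQPInfinite : {A B : Set} → Morphism A B → Set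
WeaklyQPInfinite {A} h = ∃ λ (w : Stream A) → ¬ Quasiperiodicω w × Quasiperiodicω ((h ω) w)

NotInjectiveOnWords : {A B : Set} → Morphism A B → Set
NotInjectiveOnWords {A} h = ∃ λ (u : List A) → ∃ λ (v : List A) → (u ≢ v) × ((h ⋆) u ≡ (h ⋆) v)

-- Non-injectivity of a non-erasing h yields letters a ≢ b with h b = h a ++ r; write y = h b, p = h a.
-- The word bba is not quasiperiodic, but its image y y p = (y p) (r p) is covered by the occurrences
-- of y p at 0 and at |y|. Likewise b a b^ω is not quasiperiodic (a quasiperiod covering the a would
-- also have to occur inside b^ω), while its image y p y^ω contains y p at 0 and, since y y = (y p) r,
-- at |y p| + c |y| for every c: occurrences at most |y p| apart, which cover everything.

module Submission where

open import Defs
import Algebra.Solver.Monoid as MonoidSolver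
open import Data.Empty using (⊥; ⊥-elim)
open import Data.Fin using (Fin; zero; suc; toℕ)
open import Data.Fin.Properties using () renaming (_≟_ to _≟ᶠ_)
open import Data.List using (List; []; _∷_; _++_; [_]; length; take; drop; map; applyUpTo; replicate; lookup)
open import Data.List.Properties
  using (++-assoc; ++-identityʳ; ++-identityˡ-unique; ++-conicalˡ; ++-conicalʳ; ++-cancelˡ; ++-monoid;
         length-++; length-map; length-applyUpTo; map-++; concatMap-++; upTo-∷ʳ; map-applyUpTo;
         ∷-injectiveˡ; ∷-injectiveʳ)
open import Data.Maybe using (just)
open import Data.Nat
  using (ℕ; zero; suc; _+_; _*_; _∸_; _≤_; _<_; _<?_; _≤′_; ≤′-refl; ≤′-step; z≤n; s≤s; NonZero; >-nonZero)
open import Data.Nat.DivMod using (_/_; _%_; m≡m%n+[m/n]*n; m%n<n; m/n*n≤m)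
open import Data.Nat.Properties
open import Data.Product using (∃; ∃₂; _×_; _,_; proj₁; proj₂)
open import Data.Sum using (_⊎_; inj₁; inj₂)
open import Relation.Binary.Definitions using (DecidableEquality)
open import Relation.Binary.PropositionalEquality
  using (_≡_; _≢_; refl; sym; trans; cong; cong₂; subst; module ≡-Reasoning)
open import Relation.Nullary using (¬_; yes; no)

floor-block : ∀ d s .{{_ : NonZero s}} → d / s * s ≤ d × d < d / s * s + s
floor-block d s = m/n*n≤m d s , (begin-strict
    d                   ≡⟨ m≡m%n+[m/n]*n d s ⟩
    d % s + d / s * s   <⟨ +-monoˡ-< (d / s * s) (m%n<n d s) ⟩
    s + d / s * s       ≡⟨ +-comm s (d / s * s) ⟩
    d / s * s + s       ∎)
  where open ≤-Reasoning

module _ {X : Set} where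

  infix 4 _≼_
  _≼_ : List X → List X → Set
  u ≼ v = ∃ λ r → v ≡ u ++ r

  ++-≡⇒≼-total : ∀ (u₁ u₂ v₁ v₂ : List X) → u₁ ++ u₂ ≡ v₁ ++ v₂ → u₁ ≼ v₁ ⊎ v₁ ≼ u₁
  ++-≡⇒≼-total []       _  v₁       _  _ = inj₁ (v₁ , refl)
  ++-≡⇒≼-total (x ∷ u₁) _  []       _  _ = inj₂ (x ∷ u₁ , refl)
  ++-≡⇒≼-total (x ∷ u₁) u₂ (y ∷ v₁) v₂ e with ∷-injectiveˡ e | ++-≡⇒≼-total u₁ u₂ v₁ v₂ (∷-injectiveʳ e)
  ... | refl | inj₁ (r , p) = inj₁ (r , cong (x ∷_) p)
  ... | refl | inj₂ (r , p) = inj₂ (r , cong (x ∷_) p)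

  ≼-≢[] : ∀ {p y : List X} → p ≼ y → p ≢ [] → y ≢ []
  ≼-≢[] {p} (r , refl) p≢[] y≡[] = p≢[] (++-conicalˡ p r y≡[])

  square-split : ∀ {p r y : List X} → y ≡ p ++ r → y ++ y ≡ (y ++ p) ++ r
  square-split {p} {r} refl = sym (++-assoc (p ++ r) p r)

  ≢[]⇒0<length : ∀ {u : List X} → u ≢ [] → 0 < length u
  ≢[]⇒0<length {[]}    u≢[] = ⊥-elim (u≢[] refl)
  ≢[]⇒0<length {_ ∷ _} _    = s≤s z≤n

  nth-++ˡ : ∀ (u v : List X) k → k < length u → nth (u ++ v) k ≡ nth u k
  nth-++ˡ (x ∷ u) v zero    _         = refl
  nth-++ˡ (x ∷ u) v (suc k) (s≤s k<u) = nth-++ˡ u v k k<u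

  nth-middle : ∀ (u q v : List X) (k : Fin (length (map just q))) → nth (u ++ q ++ v) (length u + toℕ k) ≡ lookup (map just q) k
  nth-middle (x ∷ u) q       v k       = nth-middle u q v k
  nth-middle []      (x ∷ q) v zero    = refl
  nth-middle []      (x ∷ q) v (suc k) = nth-middle [] q v k

  middle-index< : ∀ (u q v : List X) (k : Fin (length (map just q))) → length u + toℕ k < length (u ++ q ++ v)
  middle-index< (x ∷ u) q       v k       = s≤s (middle-index< u q v k)
  middle-index< []      (x ∷ q) v zero    = s≤s z≤n
  middle-index< []      (x ∷ q) v (suc k) = s≤s (middle-index< [] q v k)

  take-length-++ : ∀ (u v : List X) → take (length u) (u ++ v) ≡ u
  take-length-++ []      v = refl
  take-length-++ (x ∷ u) v = cong (x ∷_) (take-length-++ u v)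

  replicate-+ : ∀ m n (x : X) → replicate (m + n) x ≡ replicate m x ++ replicate n x
  replicate-+ zero    n x = refl
  replicate-+ (suc m) n x = cong (x ∷_) (replicate-+ m n x)

  applyUpTo-const : ∀ n (x : X) → applyUpTo (λ _ → x) n ≡ replicate n x
  applyUpTo-const zero    x = refl
  applyUpTo-const (suc n) x = cong (x ∷_) (applyUpTo-const n x)

  OccursAt-middle : ∀ (u q v : List X) → OccursAt q (u ++ q ++ v) (length u)
  OccursAt-middle (x ∷ u) q v with OccursAt-middle u q v
  ... | bound , occ = s≤s bound , occ
  OccursAt-middle []      q v = ≤-trans (m≤m+n (length q) (length v)) (≤-reflexive (sym (length-++ q))) , take-length-++ q v

  quasiperiodicBy-two-occurrences : ∀ {q w : List X} {i} → q ≢ [] → w ≢ q → OccursAt q w 0 → OccursAt q w i →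
    i ≤ length q → length w ≤ i + length q → QuasiperiodicBy q w
  quasiperiodicBy-two-occurrences {q} {w} {i} q≢[] w≢q occ₀ occᵢ i≤q w≤i+q = q≢[] , w≢q , cover
    where
    cover : (j : ℕ) → j < length w → ∃ λ i → (i ≤ j) × (j < i + length q) × OccursAt q w i
    cover j j<w with j <? length q
    ... | yes j<q = 0 , z≤n , j<q , occ₀
    ... | no  j≮q = i , ≤-trans i≤q (≮⇒≥ j≮q) , <-≤-trans j<w w≤i+q , occᵢ

  ≼-square-quasiperiodicBy : ∀ {p y : List X} → p ≢ [] → p ≼ y → QuasiperiodicBy (y ++ p) (y ++ y ++ p)
  ≼-square-quasiperiodicBy {p} {y} p≢[] p≼y@(r , y≡p++r) =
    quasiperiodicBy-two-occurrences q≢[] w≢q occ₀ occ₁ (≤-trans (m≤m+n _ _) (≤-reflexive (sym (length-++ y))))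
      (≤-reflexive (length-++ y))
    where
    open ≡-Reasoning
    q = y ++ p
    q≢[] : q ≢ []
    q≢[] q≡[] = p≢[] (++-conicalʳ y p q≡[])
    w≢q : y ++ q ≢ q
    w≢q w≡q = ≼-≢[] p≼y p≢[] (++-identityˡ-unique y (sym w≡q))
    yq≡q[rp] : y ++ q ≡ [] ++ q ++ r ++ p
    yq≡q[rp] = begin
      y ++ y ++ p        ≡⟨ ++-assoc y y p ⟨
      (y ++ y) ++ p      ≡⟨ cong (_++ p) (square-split y≡p++r) ⟩
      (q ++ r) ++ p      ≡⟨ ++-assoc q r p ⟩
      q ++ r ++ p        ∎
    occ₀ : OccursAt q (y ++ q) 0
    occ₀ = subst (λ w → OccursAt q w 0) (sym yq≡q[rp]) (OccursAt-middle [] q (r ++ p))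
    occ₁ : OccursAt q (y ++ q) (length y)
    occ₁ = subst (λ w → OccursAt q (y ++ w) (length y)) (++-identityʳ q) (OccursAt-middle y q [])

  bba-not-quasiperiodic : ∀ {a b : X} → a ≢ b → ¬ Quasiperiodic (b ∷ b ∷ a ∷ [])
  bba-not-quasiperiodic {a} {b} a≢b (q , q≢[] , w≢q , cover)
    with cover 0 (s≤s z≤n) | cover 2 (s≤s (s≤s (s≤s z≤n)))
  ... | zero , _ , _ , q≤3 , q₀ | i , i≤2 , 2<i+q , i+q≤3 , qᵢ = clash q i q≢[] w≢q q≤3 i≤2 2<i+q i+q≤3 q₀ qᵢ
    where
    w = b ∷ b ∷ a ∷ []
    clash : ∀ q i → q ≢ [] → w ≢ q → length q ≤ 3 → i ≤ 2 → 2 < i + length q → i + length q ≤ 3 →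
            take (length q) w ≡ q → take (length q) (drop i w) ≡ q → ⊥
    clash []                  _                   q≢[] _   _                    _              _              _                    _  _ = q≢[] refl
    clash (_ ∷ [])            0                   _    _   _                    _              (s≤s ())       _                    _  _
    clash (_ ∷ [])            1                   _    _   _                    _              (s≤s (s≤s ())) _                    _  _
    clash (_ ∷ [])            2                   _    _   _                    _              _              _                    q₀ q₂ =
      a≢b (trans (∷-injectiveˡ q₂) (sym (∷-injectiveˡ q₀)))
    clash (_ ∷ _ ∷ [])        0                   _    _   _                    _              (s≤s (s≤s ())) _                    _  _
    clash (_ ∷ _ ∷ [])        1                   _    _   _                    _              _              _                    q₀ q₁ =
      a≢b (trans (∷-injectiveˡ (∷-injectiveʳ q₁)) (sym (∷-injectiveˡ (∷-injectiveʳ q₀))))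
    clash (_ ∷ _ ∷ [])        2                   _    _   _                    _              _              (s≤s (s≤s (s≤s ()))) _  _
    clash (_ ∷ _ ∷ _ ∷ [])    _                   _    w≢q _                    _              _              _                    q₀ _ = w≢q q₀
    clash (_ ∷ _ ∷ _ ∷ _ ∷ _) _                   _    _   (s≤s (s≤s (s≤s ()))) _              _              _                    _  _
    clash _                   (suc (suc (suc _))) _    _   _                    (s≤s (s≤s ())) _              _                    _  _

  quasiperiodicByω-arithmetic-occurrences : ∀ {q : List X} {T : Stream X} {s} → q ≢ [] → 0 < s → s ≤ length q →
    OccursAtω q T 0 → (∀ c → OccursAtω q T (length q + c * s)) → QuasiperiodicByω q T
  quasiperiodicByω-arithmetic-occurrences {q} {T} {s} q≢[] 0<s s≤q occ₀ occ = q≢[] , cover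
    where
    instance
      s≢0 : NonZero s
      s≢0 = >-nonZero 0<s
    cover : (j : ℕ) → ∃ λ i → (i ≤ j) × (j < i + length q) × OccursAtω q T i
    cover j with j <? length q
    ... | yes j<q = 0 , z≤n , j<q , occ₀
    ... | no  j≮q = length q + c * s , i≤j , j<i+q , occ c
      where
      open ≤-Reasoning
      d = j ∸ length q
      c = d / s
      j≡q+d : j ≡ length q + d
      j≡q+d = sym (m+[n∸m]≡n (≮⇒≥ j≮q))
      i≤j : length q + c * s ≤ j
      i≤j = begin
        length q + c * s  ≤⟨ +-monoʳ-≤ (length q) (proj₁ (floor-block d s)) ⟩
        length q + d      ≡⟨ j≡q+d ⟨
        j                 ∎
      j<i+q : j < length q + c * s + length q
      j<i+q = begin-strict
        j                             ≡⟨ j≡q+d ⟩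
        length q + d                  <⟨ +-monoʳ-< (length q) (proj₂ (floor-block d s)) ⟩
        length q + (c * s + s)        ≡⟨ +-assoc (length q) (c * s) s ⟨
        length q + c * s + s          ≤⟨ +-monoʳ-≤ (length q + c * s) s≤q ⟩
        length q + c * s + length q   ∎

  length-prefix : ∀ (w : Stream X) n → length (prefix w n) ≡ n
  length-prefix w n = trans (length-map w (applyUpTo (λ i → i) n)) (length-applyUpTo (λ i → i) n)

  prefix-suc : ∀ (w : Stream X) n → prefix w (suc n) ≡ prefix w n ++ [ w n ]
  prefix-suc w n = trans (cong (map w) (sym (upTo-∷ʳ n))) (map-++ w _ [ n ])

  prefix-≼ : ∀ (w : Stream X) {m n} → m ≤′ n → prefix w m ≼ prefix w n
  prefix-≼ w ≤′-refl = [] , sym (++-identityʳ _)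
  prefix-≼ w {m} (≤′-step {n} m≤′n) with prefix-≼ w m≤′n
  ... | r , eq = r ++ [ w n ] , (begin
      prefix w (suc n)              ≡⟨ prefix-suc w n ⟩
      prefix w n ++ [ w n ]         ≡⟨ cong (_++ [ w n ]) eq ⟩
      (prefix w m ++ r) ++ [ w n ]  ≡⟨ ++-assoc (prefix w m) r _ ⟩
      prefix w m ++ r ++ [ w n ]    ∎)
    where open ≡-Reasoning

  bab^ω : X → X → Stream X
  bab^ω a b (suc zero) = a
  bab^ω a b _          = b

  prefix-bab^ω : ∀ (a b : X) n → prefix (bab^ω a b) (2 + n) ≡ b ∷ a ∷ replicate n b
  prefix-bab^ω a b n =
    cong (λ t → b ∷ a ∷ t) (trans (map-applyUpTo (λ i → suc (suc i)) (bab^ω a b) n) (applyUpTo-const n b))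

  bab^ω-not-quasiperiodic : ∀ {a b : X} → a ≢ b → ¬ Quasiperiodicω (bab^ω a b)
  bab^ω-not-quasiperiodic {a} {b} a≢b (q , _ , cover) with cover 1 | cover (1 + length q)
  ... | i , i≤1 , 1<i+q , occᵢ | i′ , _ , 1+q<i′+q , occᵢ′ =
    clash q i i≤1 1<i+q (+-cancelʳ-< (length q) 1 i′ 1+q<i′+q) occᵢ occᵢ′
    where
    w = bab^ω a b
    clash : ∀ q i {i′} → i ≤ 1 → 1 < i + length q → 1 < i′ → OccursAtω q w i → OccursAtω q w i′ → ⊥
    clash []          0             _        ()        _             _   _
    clash (_ ∷ [])    0             _        (s≤s ())  _             _   _
    clash (_ ∷ _ ∷ _) 0             _        _         (s≤s (s≤s _)) occ occ′ = a≢b (trans (occ (suc zero)) (sym (occ′ (suc zero))))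
    clash []          1             _        (s≤s ())  _             _   _
    clash (_ ∷ _)     1             _        _         (s≤s (s≤s _)) occ occ′ = a≢b (trans (occ zero) (sym (occ′ zero)))
    clash _           (suc (suc _)) (s≤s ()) _         _             _   _

module _ {A B : Set} (h : Morphism A B) where

  ⋆-≼ : ∀ {u v : List A} → u ≼ v → (h ⋆) u ≼ (h ⋆) v
  ⋆-≼ {u} (r , refl) = (h ⋆) r , concatMap-++ h u r

  ⋆-replicate-+ : ∀ m n a → (h ⋆) (replicate (m + n) a) ≡ (h ⋆) (replicate m a) ++ (h ⋆) (replicate n a)
  ⋆-replicate-+ m n a = trans (cong (h ⋆) (replicate-+ m n a)) (concatMap-++ h (replicate m a) _)

  length-⋆-replicate : ∀ n a → length ((h ⋆) (replicate n a)) ≡ n * length (h a)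
  length-⋆-replicate zero    a = refl
  length-⋆-replicate (suc n) a = trans (length-++ (h a)) (cong (length (h a) +_) (length-⋆-replicate n a))

  module _ (h-nonErasing : NonErasing h) where

    non-injective⇒≼-letters : DecidableEquality A → NotInjectiveOnWords h → ∃₂ λ a b → a ≢ b × h a ≼ h b
    non-injective⇒≼-letters _≟_ (u , v , u≢v , hu≡hv) = collision u v u≢v hu≡hv
      where
      collision : ∀ u v → u ≢ v → (h ⋆) u ≡ (h ⋆) v → ∃₂ λ a b → a ≢ b × h a ≼ h b
      collision []      []      u≢v _ = ⊥-elim (u≢v refl)
      collision []      (d ∷ v) _   e = ⊥-elim (h-nonErasing d (++-conicalˡ (h d) _ (sym e)))
      collision (c ∷ u) []      _   e = ⊥-elim (h-nonErasing c (++-conicalˡ (h c) _ e))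
      collision (c ∷ u) (d ∷ v) u≢v e with c ≟ d
      ... | yes refl = collision u v (λ u≡v → u≢v (cong (c ∷_) u≡v)) (++-cancelˡ (h c) _ _ e)
      ... | no c≢d with ++-≡⇒≼-total (h c) _ (h d) _ e
      ...   | inj₁ hc≼hd = c , d , c≢d , hc≼hd
      ...   | inj₂ hd≼hc = d , c , (λ d≡c → c≢d (sym d≡c)) , hd≼hc

    length-≤-⋆ : ∀ (u : List A) → length u ≤ length ((h ⋆) u)
    length-≤-⋆ []      = z≤n
    length-≤-⋆ (a ∷ u) with h a | h-nonErasing a
    ... | []    | ha≢[] = ⊥-elim (ha≢[] refl)
    ... | _ ∷ v | _     = s≤s (≤-trans (length-≤-⋆ u) (≤-trans (m≤n+m _ (length v)) (≤-reflexive (sym (length-++ v)))))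

    ω-≡-nth-⋆-prefix : ∀ (w : Stream A) {n N} → n < length ((h ⋆) (prefix w N)) → (h ω) w n ≡ nth ((h ⋆) (prefix w N)) n
    ω-≡-nth-⋆-prefix w {n} {N} n<image with ≤-total (suc n) N
    ... | inj₁ n<N with ⋆-≼ (prefix-≼ w (≤⇒≤′ n<N))
    ...   | r , eq = sym (trans (cong (λ v → nth v n) eq) (nth-++ˡ ((h ⋆) (prefix w (suc n))) r n n<image₁))
      where
      n<image₁ : n < length ((h ⋆) (prefix w (suc n)))
      n<image₁ = ≤-trans (≤-reflexive (sym (length-prefix w (suc n)))) (length-≤-⋆ (prefix w (suc n)))
    ω-≡-nth-⋆-prefix w {n} {N} n<image | inj₂ N≤n with ⋆-≼ (prefix-≼ w (≤⇒≤′ N≤n))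
    ...   | r , eq = trans (cong (λ v → nth v n) eq) (nth-++ˡ ((h ⋆) (prefix w N)) r n n<image)

    OccursAtω-⋆-prefix : ∀ (w : Stream A) {N} (u q v : List B) → (h ⋆) (prefix w N) ≡ u ++ q ++ v → OccursAtω (map just q) ((h ω) w) (length u)
    OccursAtω-⋆-prefix w {N} u q v eq k = begin
        (h ω) w (length u + toℕ k)                   ≡⟨ ω-≡-nth-⋆-prefix w {N = N} (subst (λ x → _ < length x) (sym eq) (middle-index< u q v k)) ⟩
        nth ((h ⋆) (prefix w N)) (length u + toℕ k)  ≡⟨ cong (λ x → nth x (length u + toℕ k)) eq ⟩
        nth (u ++ q ++ v) (length u + toℕ k)         ≡⟨ nth-middle u q v k ⟩
        lookup (map just q) k                        ∎
      where open ≡-Reasoning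

    image-bba-quasiperiodic : ∀ {a b} → h a ≼ h b → QuasiperiodicBy (h b ++ h a) ((h ⋆) (b ∷ b ∷ a ∷ []))
    image-bba-quasiperiodic {a} {b} ha≼hb =
      subst (QuasiperiodicBy (h b ++ h a)) (cong (λ t → h b ++ h b ++ t) (sym (++-identityʳ (h a))))
        (≼-square-quasiperiodicBy (h-nonErasing a) ha≼hb)

    image-bab^ω-quasiperiodic : ∀ {a b} → h a ≼ h b → QuasiperiodicByω (map just (h b ++ h a)) ((h ω) (bab^ω a b))
    image-bab^ω-quasiperiodic {a} {b} p≼y@(r , y≡p++r) =
      quasiperiodicByω-arithmetic-occurrences {T = (h ω) (bab^ω a b)} q≢[] 0<s s≤q occ₀ occ
      where
      open ≡-Reasoning
      w = bab^ω a b
      y = h b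
      p = h a
      q = map just (y ++ p)
      yᶜ : ℕ → List B
      yᶜ c = (h ⋆) (replicate c b)
      0<s : 0 < length y
      0<s = ≢[]⇒0<length (≼-≢[] p≼y (h-nonErasing a))
      s≤q : length y ≤ length q
      s≤q = ≤-trans (m≤m+n (length y) (length p)) (≤-reflexive (sym (trans (length-map just (y ++ p)) (length-++ y))))
      q≢[] : q ≢ []
      q≢[] q≡[] = <⇒≢ (<-≤-trans 0<s s≤q) (sym (cong length q≡[]))
      occ₀ : OccursAtω q ((h ω) w) 0
      occ₀ = OccursAtω-⋆-prefix w {2} [] (y ++ p) [] (sym (++-assoc y p []))
      image : ∀ c → (h ⋆) (prefix w (2 + (c + 2))) ≡ (y ++ p ++ yᶜ c) ++ (y ++ p) ++ r
      image c = begin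
        (h ⋆) (prefix w (2 + (c + 2)))          ≡⟨ cong (h ⋆) (prefix-bab^ω a b (c + 2)) ⟩
        y ++ p ++ (h ⋆) (replicate (c + 2) b)   ≡⟨ cong (λ t → y ++ p ++ t) (⋆-replicate-+ c 2 b) ⟩
        y ++ p ++ yᶜ c ++ y ++ y ++ []          ≡⟨ solve 3 (λ y p z → y ⊕ p ⊕ z ⊕ y ⊕ y ⊕ id ⊜ (y ⊕ p ⊕ z) ⊕ y ⊕ y) refl y p (yᶜ c) ⟩
        (y ++ p ++ yᶜ c) ++ y ++ y              ≡⟨ cong ((y ++ p ++ yᶜ c) ++_) (square-split y≡p++r) ⟩
        (y ++ p ++ yᶜ c) ++ (y ++ p) ++ r       ∎
        where open MonoidSolver (++-monoid B) using (solve; _⊜_; _⊕_; id)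
      position : ∀ c → length (y ++ p ++ yᶜ c) ≡ length q + c * length y
      position c = begin
        length (y ++ p ++ yᶜ c)            ≡⟨ cong length (++-assoc y p (yᶜ c)) ⟨
        length ((y ++ p) ++ yᶜ c)          ≡⟨ length-++ (y ++ p) ⟩
        length (y ++ p) + length (yᶜ c)    ≡⟨ cong₂ _+_ (length-map just (y ++ p)) (sym (length-⋆-replicate c b)) ⟨
        length q + c * length y            ∎
      occ : ∀ c → OccursAtω q ((h ω) w) (length q + c * length y)
      occ c = subst (OccursAtω q ((h ω) w)) (position c) (OccursAtω-⋆-prefix w {2 + (c + 2)} (y ++ p ++ yᶜ c) (y ++ p) r (image c))

corollary6p2 : (m k : ℕ) → 2 ≤ m → (h : Morphism (Fin m) (Fin k)) →
    NonErasing h → NotInjectiveOnWords h →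
    WeaklyQPFinite h × WeaklyQPInfinite h
corollary6p2 m k _ h h-nonErasing h-nonInjective
  with non-injective⇒≼-letters h h-nonErasing _≟ᶠ_ h-nonInjective
... | a , b , a≢b , ha≼hb =
  (b ∷ b ∷ a ∷ [] , bba-not-quasiperiodic a≢b , h b ++ h a , image-bba-quasiperiodic h h-nonErasing ha≼hb) ,
  (bab^ω a b , bab^ω-not-quasiperiodic a≢b , map just (h b ++ h a) , image-bab^ω-quasiperiodic h h-nonErasing ha≼hb)
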